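{- Let $G=(V,E)$ be a strongly connected directed graph, $\mathcal{C}^{=}$ a partition of $E$ such that every part $C\in\mathcal{C}^{=}$ satisfies $C\subseteq\delta^+(v)$ for some vertex $v$, and let $ts\in E$. Then there exists $x\in\mathbb{R}^E_{\ge0}$ with $x(\delta^+(v))=x(\delta^-(v))$ for all $v\in V$, $x_e=x_{e'}$ whenever $e,e'$ lie in a common part of $\mathcal{C}^{=}$, and $x_{ts}>0$.
   Context: $\delta^+(v),\delta^-(v)$ are the sets of outgoing/incoming arcs of $v$, and $x(A)=\sum_{e\in A}x_e$. -}

module Defs where

open import Data.Nat using (ℕ; zero; suc)
open import Data.Fin using (Fin; zero; suc; _≟_)
open import Data.Product using (_×_; _,_)
open import Data.Rational using (ℚ; 0ℚ; _+_)
open import Relation.Nullary using (does)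
open import Data.Bool using (if_then_else_)
open import Relation.Binary.PropositionalEquality using (_≡_)
open import Function.Definitions using (Injective)

record Digraph (n m : ℕ) : Set where
  field
    tail : Fin m → Fin n
    head : Fin m → Fin n

open Digraph public

-- Arcs are determined by their endpoints (E ⊆ V × V).
endpoints : ∀ {n m} → Digraph n m → Fin m → Fin n × Fin n
endpoints G e = tail G e , head G e

Simple : ∀ {n m} → Digraph n m → Set
Simple G = Injective _≡_ _≡_ (endpoints G)

data Walk {n m : ℕ} (G : Digraph n m) : Fin n → Fin n → Set where
  stay : ∀ {u} → Walk G u u
  step : ∀ {v} (e : Fin m) → Walk G (head G e) v → Walk G (tail G e) v

StronglyConnected : ∀ {n m} → Digraph n m → Set
StronglyConnected {n} G = (u v : Fin n) → Walk G u v

sumFin : ∀ {m} → (Fin m → ℚ) → ℚ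
sumFin {zero} f = 0ℚ
sumFin {suc m} f = f zero + sumFin (λ i → f (suc i))

outSum : ∀ {n m} → Digraph n m → (Fin m → ℚ) → Fin n → ℚ
outSum G x v = sumFin (λ e → if does (tail G e ≟ v) then x e else 0ℚ)

inSum : ∀ {n m} → Digraph n m → (Fin m → ℚ) → Fin n → ℚ
inSum G x v = sumFin (λ e → if does (head G e ≟ v) then x e else 0ℚ)

-- Set x e := y (tail e) for a vertex weighting y. Then x is constant on every part, since a part
-- lies in some δ⁺(v), and flow conservation at v reads y v · deg⁺ v = Σ_u y u · #arcs(u,v): y is a
-- stationary measure of the random walk on G. A strongly connected nonnegative integer matrix has a
-- positive integral stationary measure, by induction on the number of vertices: eliminate a vertex
-- by short-cutting every two-step path through it, solve the smaller strongly connected system,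
-- and read the weight of the eliminated vertex off its inflow.
module Submission where

open import Defs
open import Data.Nat using (ℕ)
open import Data.Fin using (Fin)
open import Data.Product using (Σ; _×_; ∃)
open import Data.Rational using (ℚ; 0ℚ; _≤_; _<_)
open import Relation.Binary.PropositionalEquality using (_≡_)

open import Data.Nat using (zero; suc; _+_; _*_; z≤n; s≤s)
  renaming (_≤_ to _≤ₙ_; _<_ to _<ₙ_)
open import Data.Nat.Properties
  using (+-*-semiring; +-comm; *-comm; *-assoc; *-distribˡ-+; *-identityˡ; *-identityʳ; *-zeroʳ; +-identityʳ;
         ≤-trans; <-≤-trans; m≤m+n; m≤n+m)
open import Data.Nat.Tactic.RingSolver using (solve-∀)
open import Algebra.Properties.Semiring.Sum +-*-semiring
  using (sum; sum-replicate-zero; sum-cong-≗; ∑-distrib-+; ∑-comm; *-distribˡ-sum; *-distribʳ-sum)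
open import Data.Fin using (zero; suc; _≟_)
open import Data.Product using (_,_)
open import Data.Bool using (Bool; if_then_else_)
open import Data.Bool.Properties using (if-float)
open import Relation.Nullary using (does; yes; no)
open import Relation.Binary.PropositionalEquality using (refl; sym; trans; cong; cong₂; module ≡-Reasoning)
open import Data.Empty using (⊥-elim)
import Data.Rational as ℚ
import Data.Rational.Properties as ℚP
open import Algebra.Properties.Monoid.Mult ℚP.+-0-monoid using (×-homo-+) renaming (_×_ to _·_)

open ≡-Reasoning

≤-sum : ∀ {n} (f : Fin n → ℕ) i → f i ≤ₙ sum f
≤-sum f zero    = m≤m+n _ _
≤-sum f (suc i) = ≤-trans (≤-sum (λ j → f (suc j)) i) (m≤n+m _ _)

*-pos : ∀ {a b} → 0 <ₙ a → 0 <ₙ b → 0 <ₙ a * b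
*-pos {suc a} {suc b} _ _ = s≤s z≤n

kronecker : ∀ {n} → Fin n → Fin n → ℕ
kronecker a b = if does (a ≟ b) then 1 else 0

kronecker-refl : ∀ {n} (a : Fin n) → kronecker a a ≡ 1
kronecker-refl a with a ≟ a
... | yes _  = refl
... | no a≢a = ⊥-elim (a≢a refl)

if-≟-kronecker : ∀ {n} (a b : Fin n) c → (if does (a ≟ b) then c else 0) ≡ c * kronecker a b
if-≟-kronecker a b c with a ≟ b
... | yes _ = sym (*-identityʳ c)
... | no _  = sym (*-zeroʳ c)

*-kronecker-subst : ∀ {n} (f : Fin n → ℕ) (a b : Fin n) → f a * kronecker a b ≡ f b * kronecker a b
*-kronecker-subst f a b with a ≟ b
... | yes refl = refl
... | no _     = trans (*-zeroʳ (f a)) (sym (*-zeroʳ (f b)))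

sum-*-kronecker : ∀ {n} (f : Fin n → ℕ) (a : Fin n) → sum (λ u → f u * kronecker a u) ≡ f a
sum-*-kronecker {suc n} f zero = begin
  f zero * 1 + sum (λ u → f (suc u) * 0)
    ≡⟨ cong₂ _+_ (*-identityʳ (f zero)) (sum-cong-≗ (λ u → *-zeroʳ (f (suc u)))) ⟩
  f zero + sum {n} (λ _ → 0)
    ≡⟨ cong (f zero +_) (sum-replicate-zero n) ⟩
  f zero + 0
    ≡⟨ +-identityʳ (f zero) ⟩
  f zero
    ∎
sum-*-kronecker {suc n} f (suc a) = begin
  f zero * 0 + sum (λ u → f (suc u) * kronecker a u)
    ≡⟨ cong (_+ sum (λ u → f (suc u) * kronecker a u)) (*-zeroʳ (f zero)) ⟩
  sum (λ u → f (suc u) * kronecker a u)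
    ≡⟨ sum-*-kronecker (λ u → f (suc u)) a ⟩
  f (suc a)
    ∎

sum-kronecker : ∀ {n} (a : Fin n) → sum (kronecker a) ≡ 1
sum-kronecker a = trans (sum-cong-≗ (λ u → sym (*-identityˡ (kronecker a u)))) (sum-*-kronecker (λ _ → 1) a)

Matrix : ℕ → Set
Matrix n = Fin n → Fin n → ℕ

data Path {n} (W : Matrix n) : Fin n → Fin n → Set where
  []  : ∀ {u} → Path W u u
  _∷_ : ∀ {u v w} → 0 <ₙ W u v → Path W v w → Path W u w

Irreducible : ∀ {n} → Matrix n → Set
Irreducible {n} W = (u v : Fin n) → Path W u v

Positive : ∀ {n} → (Fin n → ℕ) → Set
Positive {n} y = (v : Fin n) → 0 <ₙ y v

Stationary : ∀ {n} → Matrix n → (Fin n → ℕ) → Set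
Stationary {n} W y = (v : Fin n) → y v * sum (W v) ≡ sum (λ u → y u * W u v)

-- The stochastic complement of vertex zero, cleared of denominators: a path u → zero → v becomes an
-- arc of weight W u zero · W zero v, and direct arcs are rescaled by out₀, the weight leaving zero
-- (loops at zero do not count).
module Elimination {k : ℕ} (W : Matrix (suc (suc k))) where

  out₀ : ℕ
  out₀ = sum (λ z → W zero (suc z))

  reduced : Matrix (suc k)
  reduced u v = out₀ * W (suc u) (suc v) + W (suc u) zero * W zero (suc v)

  out₀-pos : ∀ {v} → Path W zero (suc v) → 0 <ₙ out₀
  out₀-pos (_∷_ {v = zero}  _   p) = out₀-pos p
  out₀-pos (_∷_ {v = suc z} W>0 _) = <-≤-trans W>0 (≤-sum (λ z → W zero (suc z)) z)

  inflow₀-pos : ∀ {v} (y : Fin (suc k) → ℕ) → Positive y → Path W (suc v) zero →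
                0 <ₙ sum (λ u → y u * W (suc u) zero)
  inflow₀-pos y y>0 (_∷_ {u = suc u} {v = zero}  W>0 _) =
    <-≤-trans (*-pos (y>0 u) W>0) (≤-sum (λ u → y u * W (suc u) zero) u)
  inflow₀-pos y y>0 (_∷_ {v = suc _} _ p) = inflow₀-pos y y>0 p

  module _ (out₀>0 : 0 <ₙ out₀) where

    direct : ∀ {u v} → 0 <ₙ W (suc u) (suc v) → 0 <ₙ reduced u v
    direct W>0 = <-≤-trans (*-pos out₀>0 W>0) (m≤m+n _ _)

    via₀ : ∀ {u v} → 0 <ₙ W (suc u) zero → 0 <ₙ W zero (suc v) → 0 <ₙ reduced u v
    via₀ W>0 W′>0 = <-≤-trans (*-pos W>0 W′>0) (m≤n+m _ _)

    -- A path that currently stands at zero continues as a reduced path from any vertex that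
    -- could have stepped into zero.
    ReducedPath : Fin (suc k) → Fin (suc (suc k)) → Set
    ReducedPath v (suc u) = Path reduced u v
    ReducedPath v zero    = ∀ u → 0 <ₙ W (suc u) zero → Path reduced u v

    shortcut : ∀ {a v} → Path W a (suc v) → ReducedPath v a
    shortcut []                                   = []
    shortcut (_∷_ {u = suc u} {v = suc _} W>0 p) = direct W>0 ∷ shortcut p
    shortcut (_∷_ {u = suc u} {v = zero}  W>0 p) = shortcut p u W>0
    shortcut (_∷_ {u = zero}  {v = suc _} W>0 p) = λ u W′>0 → via₀ W′>0 W>0 ∷ shortcut p
    shortcut (_∷_ {u = zero}  {v = zero}  _   p) = shortcut p

  reduced-irreducible : Irreducible W → Irreducible reduced
  reduced-irreducible W-irr u v = shortcut (out₀-pos (W-irr zero (suc zero))) (W-irr (suc u) (suc v))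

  lift : (Fin (suc k) → ℕ) → Fin (suc (suc k)) → ℕ
  lift y zero    = sum (λ u → y u * W (suc u) zero)
  lift y (suc u) = out₀ * y u

  lift-positive : Irreducible W → ∀ y → Positive y → Positive (lift y)
  lift-positive W-irr y y>0 zero    = inflow₀-pos y y>0 (W-irr (suc zero) zero)
  lift-positive W-irr y y>0 (suc u) = *-pos (out₀-pos (W-irr zero (suc zero))) (y>0 u)

  scaled-inflow : ∀ y v →
                  sum (λ u → lift y (suc u) * W (suc u) v) ≡ out₀ * sum (λ u → y u * W (suc u) v)
  scaled-inflow y v = begin
    sum (λ u → out₀ * y u * W (suc u) v)   ≡⟨ sum-cong-≗ (λ u → *-assoc out₀ (y u) (W (suc u) v)) ⟩
    sum (λ u → out₀ * (y u * W (suc u) v)) ≡⟨ sym (*-distribˡ-sum out₀ (λ u → y u * W (suc u) v)) ⟩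
    out₀ * sum (λ u → y u * W (suc u) v)   ∎

  reduced-outweight : ∀ v →
                      sum (reduced v) ≡ out₀ * sum (λ z → W (suc v) (suc z)) + W (suc v) zero * out₀
  reduced-outweight v = begin
    sum (reduced v)
      ≡⟨ ∑-distrib-+ (λ z → out₀ * W (suc v) (suc z)) (λ z → W (suc v) zero * W zero (suc z)) ⟩
    sum (λ z → out₀ * W (suc v) (suc z)) + sum (λ z → W (suc v) zero * W zero (suc z))
      ≡⟨ sym (cong₂ _+_ (*-distribˡ-sum out₀ (λ z → W (suc v) (suc z)))
                       (*-distribˡ-sum (W (suc v) zero) (λ z → W zero (suc z)))) ⟩
    out₀ * sum (λ z → W (suc v) (suc z)) + W (suc v) zero * out₀
      ∎

  reduced-inflow : ∀ y v → sum (λ u → y u * reduced u v) ≡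
                   out₀ * sum (λ u → y u * W (suc u) (suc v)) + lift y zero * W zero (suc v)
  reduced-inflow y v = begin
    sum (λ u → y u * reduced u v)
      ≡⟨ sum-cong-≗ (λ u → expand (y u) out₀ (W (suc u) (suc v)) (W (suc u) zero) (W zero (suc v))) ⟩
    sum (λ u → out₀ * (y u * W (suc u) (suc v)) + y u * W (suc u) zero * W zero (suc v))
      ≡⟨ ∑-distrib-+ (λ u → out₀ * (y u * W (suc u) (suc v)))
                     (λ u → y u * W (suc u) zero * W zero (suc v)) ⟩
    sum (λ u → out₀ * (y u * W (suc u) (suc v))) + sum (λ u → y u * W (suc u) zero * W zero (suc v))
      ≡⟨ sym (cong₂ _+_ (*-distribˡ-sum out₀ (λ u → y u * W (suc u) (suc v)))
                       (*-distribʳ-sum (W zero (suc v)) (λ u → y u * W (suc u) zero))) ⟩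
    out₀ * sum (λ u → y u * W (suc u) (suc v)) + lift y zero * W zero (suc v)
      ∎
    where
      expand : ∀ y o w a d → y * (o * w + a * d) ≡ o * (y * w) + y * a * d
      expand = solve-∀

  lift-stationary : ∀ y → Stationary reduced y → Stationary W (lift y)
  lift-stationary y y-st zero = begin
    Y * (W zero zero + out₀)                 ≡⟨ *-distribˡ-+ Y (W zero zero) out₀ ⟩
    Y * W zero zero + Y * out₀               ≡⟨ cong (Y * W zero zero +_) (*-comm Y out₀) ⟩
    Y * W zero zero + out₀ * Y               ≡⟨ cong (Y * W zero zero +_) (sym (scaled-inflow y zero)) ⟩
    Y * W zero zero + sum (λ u → lift y (suc u) * W (suc u) zero) ∎
    where Y = lift y zero
  lift-stationary y y-st (suc v) = begin
    out₀ * y v * (W (suc v) zero + A)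
      ≡⟨ regroup out₀ (y v) (W (suc v) zero) A ⟩
    y v * (out₀ * A + W (suc v) zero * out₀)
      ≡⟨ cong (y v *_) (sym (reduced-outweight v)) ⟩
    y v * sum (reduced v)
      ≡⟨ y-st v ⟩
    sum (λ u → y u * reduced u v)
      ≡⟨ reduced-inflow y v ⟩
    out₀ * sum (λ u → y u * W (suc u) (suc v)) + lift y zero * W zero (suc v)
      ≡⟨ cong₂ _+_ (sym (scaled-inflow y (suc v))) refl ⟩
    sum (λ u → lift y (suc u) * W (suc u) (suc v)) + lift y zero * W zero (suc v)
      ≡⟨ +-comm (sum (λ u → lift y (suc u) * W (suc u) (suc v))) (lift y zero * W zero (suc v)) ⟩
    lift y zero * W zero (suc v) + sum (λ u → lift y (suc u) * W (suc u) (suc v))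
      ∎
    where
      A : ℕ
      A = sum (λ z → W (suc v) (suc z))
      regroup : ∀ o y b a → o * y * (b + a) ≡ y * (o * a + b * o)
      regroup = solve-∀

open Elimination using (reduced; reduced-irreducible; lift; lift-positive; lift-stationary)

irreducible⇒stationary : ∀ {n} (W : Matrix n) → Irreducible W →
                         ∃ λ (y : Fin n → ℕ) → Positive y × Stationary W y
irreducible⇒stationary {zero}        W _ = (λ ()) , (λ ()) , (λ ())
irreducible⇒stationary {suc zero}    W _ = (λ _ → 1) , (λ _ → s≤s z≤n) , one-vertex
  where
    one-vertex : Stationary W (λ _ → 1)
    one-vertex zero = cong (λ w → w + 0) (trans (*-identityˡ _) (sym (*-identityˡ _)))
irreducible⇒stationary {suc (suc k)} W W-irr =
  let y , y>0 , y-st = irreducible⇒stationary (reduced W) (reduced-irreducible W W-irr)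
  in  lift W y , lift-positive W W-irr y y>0 , lift-stationary W y y-st

module _ {n m : ℕ} (G : Digraph n m) where

  arcCount : Matrix n
  arcCount u v = sum (λ e → kronecker (tail G e) u * kronecker (head G e) v)

  arcCount-pos : ∀ e → 0 <ₙ arcCount (tail G e) (head G e)
  arcCount-pos e =
    <-≤-trans arc-e (≤-sum (λ e′ → kronecker (tail G e′) (tail G e) * kronecker (head G e′) (head G e)) e)
    where
      arc-e : 0 <ₙ kronecker (tail G e) (tail G e) * kronecker (head G e) (head G e)
      arc-e rewrite kronecker-refl (tail G e) | kronecker-refl (head G e) = s≤s z≤n

  walk⇒path : ∀ {u v} → Walk G u v → Path arcCount u v
  walk⇒path stay       = []
  walk⇒path (step e w) = arcCount-pos e ∷ walk⇒path w

  outdegree : ∀ v → sum (arcCount v) ≡ sum (λ e → kronecker (tail G e) v)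
  outdegree v = begin
    sum (λ z → sum (λ e → kronecker (tail G e) v * kronecker (head G e) z))
      ≡⟨ ∑-comm (λ z e → kronecker (tail G e) v * kronecker (head G e) z) ⟩
    sum (λ e → sum (λ z → kronecker (tail G e) v * kronecker (head G e) z))
      ≡⟨ sum-cong-≗ (λ e → sym (*-distribˡ-sum (kronecker (tail G e) v) (kronecker (head G e)))) ⟩
    sum (λ e → kronecker (tail G e) v * sum (kronecker (head G e)))
      ≡⟨ sum-cong-≗ (λ e →
           trans (cong (kronecker (tail G e) v *_) (sum-kronecker (head G e))) (*-identityʳ _)) ⟩
    sum (λ e → kronecker (tail G e) v)
      ∎

  inflow : ∀ (y : Fin n → ℕ) v →
           sum (λ u → y u * arcCount u v) ≡ sum (λ e → y (tail G e) * kronecker (head G e) v)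
  inflow y v = begin
    sum (λ u → y u * arcCount u v)
      ≡⟨ sum-cong-≗ (λ u → *-distribˡ-sum (y u) (λ e → kronecker (tail G e) u * kronecker (head G e) v)) ⟩
    sum (λ u → sum (λ e → y u * (kronecker (tail G e) u * kronecker (head G e) v)))
      ≡⟨ ∑-comm (λ u e → y u * (kronecker (tail G e) u * kronecker (head G e) v)) ⟩
    sum (λ e → sum (λ u → y u * (kronecker (tail G e) u * kronecker (head G e) v)))
      ≡⟨ sum-cong-≗ (λ e → sum-cong-≗ (λ u →
           sym (*-assoc (y u) (kronecker (tail G e) u) (kronecker (head G e) v)))) ⟩
    sum (λ e → sum (λ u → y u * kronecker (tail G e) u * kronecker (head G e) v))
      ≡⟨ sum-cong-≗ (λ e →
           sym (*-distribʳ-sum (kronecker (head G e) v) (λ u → y u * kronecker (tail G e) u))) ⟩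
    sum (λ e → sum (λ u → y u * kronecker (tail G e) u) * kronecker (head G e) v)
      ≡⟨ sum-cong-≗ (λ e → cong (_* kronecker (head G e) v) (sum-*-kronecker y (tail G e))) ⟩
    sum (λ e → y (tail G e) * kronecker (head G e) v)
      ∎

  stationary⇒conservation : ∀ y → Stationary arcCount y → ∀ v →
    sum (λ e → if does (tail G e ≟ v) then y (tail G e) else 0) ≡
    sum (λ e → if does (head G e ≟ v) then y (tail G e) else 0)
  stationary⇒conservation y y-st v = begin
    sum (λ e → if does (tail G e ≟ v) then y (tail G e) else 0)
      ≡⟨ sum-cong-≗ (λ e → trans (if-≟-kronecker (tail G e) v _) (*-kronecker-subst y (tail G e) v)) ⟩
    sum (λ e → y v * kronecker (tail G e) v)
      ≡⟨ sym (*-distribˡ-sum (y v) (λ e → kronecker (tail G e) v)) ⟩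
    y v * sum (λ e → kronecker (tail G e) v)
      ≡⟨ cong (y v *_) (sym (outdegree v)) ⟩
    y v * sum (arcCount v)
      ≡⟨ y-st v ⟩
    sum (λ u → y u * arcCount u v)
      ≡⟨ inflow y v ⟩
    sum (λ e → y (tail G e) * kronecker (head G e) v)
      ≡⟨ sum-cong-≗ (λ e → sym (if-≟-kronecker (head G e) v _)) ⟩
    sum (λ e → if does (head G e ≟ v) then y (tail G e) else 0)
      ∎

fromℕ : ℕ → ℚ
fromℕ a = a · ℚ.1ℚ

fromℕ-nonneg : ∀ a → 0ℚ ≤ fromℕ a
fromℕ-nonneg zero    = ℚP.≤-refl
fromℕ-nonneg (suc a) = ℚP.+-mono-≤ (ℚP.<⇒≤ (ℚP.positive⁻¹ ℚ.1ℚ)) (fromℕ-nonneg a)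

fromℕ-pos : ∀ a → 0 <ₙ a → 0ℚ < fromℕ a
fromℕ-pos (suc a) _ = ℚP.+-mono-<-≤ (ℚP.positive⁻¹ ℚ.1ℚ) (fromℕ-nonneg a)

sumFin-fromℕ : ∀ {m} (f : Fin m → ℕ) → sumFin (λ e → fromℕ (f e)) ≡ fromℕ (sum f)
sumFin-fromℕ {zero}  f = refl
sumFin-fromℕ {suc m} f = begin
  fromℕ (f zero) ℚ.+ sumFin (λ e → fromℕ (f (suc e)))
    ≡⟨ cong (fromℕ (f zero) ℚ.+_) (sumFin-fromℕ (λ e → f (suc e))) ⟩
  fromℕ (f zero) ℚ.+ fromℕ (sum (λ e → f (suc e)))
    ≡⟨ sym (×-homo-+ ℚ.1ℚ (f zero) (sum (λ e → f (suc e)))) ⟩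
  fromℕ (sum f)
    ∎

sumFin-cong : ∀ {m} {f g : Fin m → ℚ} → (∀ i → f i ≡ g i) → sumFin f ≡ sumFin g
sumFin-cong {zero}  f≗g = refl
sumFin-cong {suc m} f≗g = cong₂ ℚ._+_ (f≗g zero) (sumFin-cong (λ i → f≗g (suc i)))

sumFin-if-fromℕ : ∀ {m} (b : Fin m → Bool) (f : Fin m → ℕ) →
  sumFin (λ e → if b e then fromℕ (f e) else 0ℚ) ≡ fromℕ (sum (λ e → if b e then f e else 0))
sumFin-if-fromℕ b f =
  trans (sumFin-cong (λ e → sym (if-float fromℕ (b e)))) (sumFin-fromℕ (λ e → if b e then f e else 0))

corollary1 : ∀ {n m k : ℕ} (G : Digraph n m) → Simple G → StronglyConnected G →
    (part : Fin m → Fin k) →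
    ((c : Fin k) → ∃ λ (v : Fin n) → (e : Fin m) → part e ≡ c → tail G e ≡ v) →
    (ts : Fin m) →
    Σ (Fin m → ℚ) λ x →
    ((e : Fin m) → 0ℚ ≤ x e) ×
    ((v : Fin n) → outSum G x v ≡ inSum G x v) ×
    ((e e′ : Fin m) → part e ≡ part e′ → x e ≡ x e′) ×
    (0ℚ < x ts)
corollary1 {m = m} G _ G-sc part part⊆δ⁺ ts
  with irreducible⇒stationary (arcCount G) (λ u v → walk⇒path G (G-sc u v))
... | y , y>0 , y-st =
  x , (λ e → fromℕ-nonneg (y (tail G e))) , conservation , constant-on-parts , fromℕ-pos _ (y>0 (tail G ts))
  where
    x : Fin m → ℚ
    x e = fromℕ (y (tail G e))

    conservation : ∀ v → outSum G x v ≡ inSum G x v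
    conservation v = begin
      outSum G x v
        ≡⟨ sumFin-if-fromℕ (λ e → does (tail G e ≟ v)) (λ e → y (tail G e)) ⟩
      fromℕ (sum (λ e → if does (tail G e ≟ v) then y (tail G e) else 0))
        ≡⟨ cong fromℕ (stationary⇒conservation G y y-st v) ⟩
      fromℕ (sum (λ e → if does (head G e ≟ v) then y (tail G e) else 0))
        ≡⟨ sym (sumFin-if-fromℕ (λ e → does (head G e ≟ v)) (λ e → y (tail G e))) ⟩
      inSum G x v
        ∎

    constant-on-parts : ∀ e e′ → part e ≡ part e′ → x e ≡ x e′
    constant-on-parts e e′ same with part⊆δ⁺ (part e′)
    ... | v , tail≡v = cong (λ t → fromℕ (y t)) (trans (tail≡v e same) (sym (tail≡v e′ refl)))
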